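{- For any sets $A,B$ of nonnegative integers that are additive complements, $$SX(A,B):=\limsup_{x\to\infty}\frac{\max\{A(x),B(x)\}}{\sqrt x}\ \ge\ \sqrt{1+C_0},\qquad\text{where } C_0=\tfrac12\left(-3-\sqrt2+\sqrt{3+12\sqrt2}\right).$$
   Context: Two sets $A,B$ of nonnegative integers are called additive complements if every sufficiently large integer can be written as $a+b$ with $a\in A$, $b\in B$. For a set $A$ of nonnegative integers, $A(x)$ denotes the number of elements $a\in A$ with $a\le x$. Note $\sqrt{1+C_0}=1.013565\ldots$. -}

module Defs where

open import Data.Nat using (ℕ; zero; suc; _+_; _*_; _∸_; _^_; _≤_; _<_; _⊔_)
open import Data.Bool using (Bool; true; false)
open import Data.Product using (Σ; ∃; _×_; _,_)
open import Relation.Binary.PropositionalEquality using (_≡_)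
open import Relation.Nullary using (¬_)

NatSet : Set
NatSet = ℕ → Bool

_∈ₛ_ : ℕ → NatSet → Set
n ∈ₛ A = A n ≡ true

count : NatSet → ℕ → ℕ
count A zero = if0 (A zero)
  where
  if0 : Bool → ℕ
  if0 true = 1
  if0 false = 0
count A (suc x) = count A x + ind (A (suc x))
  where
  ind : Bool → ℕ
  ind true = 1
  ind false = 0

AdditiveComplements : NatSet → NatSet → Set
AdditiveComplements A B =
  Σ ℕ λ N → ∀ n → N ≤ n → Σ ℕ λ a → Σ ℕ λ b → a ∈ₛ A × b ∈ₛ B × a + b ≡ n

-- The rational p / r (r ≥ 1) is strictly below sqrt(1 + C0), where
-- C0 = (-3 - √2 + √(3 + 12√2)) / 2.  With t = p²/r², the condition
-- t < 1 + C0 = (-1 - √2 + √(3+12√2))/2 is equivalent to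
-- 2t < 5  and  2 t² (t+1)² < (5 - 2t)², i.e. (clearing denominators)
-- 2p² < 5r²  and  2 p⁴ (p² + r²)² < r⁴ (5r² - 2p²)².
BelowSqrt1+C0 : ℕ → ℕ → Set
BelowSqrt1+C0 p r =
  (2 * p ^ 2 < 5 * r ^ 2) ×
  (2 * p ^ 4 * (p ^ 2 + r ^ 2) ^ 2 < r ^ 4 * (5 * r ^ 2 ∸ 2 * p ^ 2) ^ 2)

-- limsup_{x→∞} max{A(x),B(x)} / √x ≥ sqrt(1+C0), written out:
-- for every rational q = p/r < sqrt(1+C0), it is not the case that
-- eventually max{A(x),B(x)} ≤ q √x (i.e. r² max² ≤ p² x).
LimsupMaxAtLeastSqrt1+C0 : NatSet → NatSet → Set
LimsupMaxAtLeastSqrt1+C0 A B =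
  ∀ p r → 1 ≤ r → BelowSqrt1+C0 p r →
    ¬ (Σ ℕ λ N → ∀ x → N ≤ x →
         r ^ 2 * (count A x ⊔ count B x) ^ 2 ≤ p ^ 2 * x)

-- Let F(x) count the pairs (a, b) ∈ A × B with a + b ≤ x.  Every large n has a
-- representation, so F(x) ≥ x − N.  Splitting the pairs according to a ≤ y or a > y
-- gives F(x) ≤ A(x) B(x − y) + A(y) (B(x) − B(x − y)).  If max{A(t), B(t)} ≤ q √t
-- from some point on, take x = 25 Q, y = 9 Q with Q a large square: the right hand
-- side is at most 23 q² Q, so q² ≥ 25/23.  Since 25/23 > 1 + C₀, no q < √(1 + C₀)
-- bounds max{A(x), B(x)} / √x eventually.
module Submission where

open import Defs
open import Data.Bool using (Bool; true; false)
open import Data.Nat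
open import Data.Nat.Properties
open import Algebra.Properties.CommutativeSemigroup +-commutativeSemigroup
  using () renaming (interchange to +-interchange)
open import Data.Nat.Tactic.RingSolver using (solve-∀)
open import Data.Product using (_,_; proj₁)
open import Function using (_∘_)
open import Relation.Binary.PropositionalEquality
open import Relation.Nullary using (yes; no; contradiction)

𝟙 : Bool → ℕ
𝟙 true = 1
𝟙 false = 0

∑≤ : ℕ → (ℕ → ℕ) → ℕ
∑≤ zero f = f 0
∑≤ (suc n) f = ∑≤ n f + f (suc n)

syntax ∑≤ n (λ a → e) = ∑[ a ≤ n ] e

∑≤-cong : ∀ n {f g} → (∀ a → a ≤ n → f a ≡ g a) → ∑≤ n f ≡ ∑≤ n g
∑≤-cong zero f≡g = f≡g 0 z≤n
∑≤-cong (suc n) f≡g =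
  cong₂ _+_ (∑≤-cong n (λ a a≤n → f≡g a (m≤n⇒m≤1+n a≤n))) (f≡g (suc n) ≤-refl)

∑≤-mono : ∀ n {f g} → (∀ a → a ≤ n → f a ≤ g a) → ∑≤ n f ≤ ∑≤ n g
∑≤-mono zero f≤g = f≤g 0 z≤n
∑≤-mono (suc n) f≤g =
  +-mono-≤ (∑≤-mono n (λ a a≤n → f≤g a (m≤n⇒m≤1+n a≤n))) (f≤g (suc n) ≤-refl)

∑≤-monoʳ : ∀ f {m n} → m ≤ n → ∑≤ m f ≤ ∑≤ n f
∑≤-monoʳ f m≤n = go (≤⇒≤′ m≤n)
  where
  go : ∀ {m n} → m ≤′ n → ∑≤ m f ≤ ∑≤ n f
  go ≤′-refl = ≤-refl
  go (≤′-step m≤′n) = ≤-trans (go m≤′n) (m≤m+n _ _)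

∑≤-distrib-+ : ∀ n f g → ∑[ a ≤ n ] (f a + g a) ≡ ∑≤ n f + ∑≤ n g
∑≤-distrib-+ zero f g = refl
∑≤-distrib-+ (suc n) f g = begin
  ∑[ a ≤ n ] (f a + g a) + (f (suc n) + g (suc n))
    ≡⟨ cong (_+ (f (suc n) + g (suc n))) (∑≤-distrib-+ n f g) ⟩
  (∑≤ n f + ∑≤ n g) + (f (suc n) + g (suc n))
    ≡⟨ +-interchange (∑≤ n f) (∑≤ n g) (f (suc n)) (g (suc n)) ⟩
  ∑≤ (suc n) f + ∑≤ (suc n) g ∎
  where open ≡-Reasoning

∑≤-distribʳ-* : ∀ n f c → ∑[ a ≤ n ] (f a * c) ≡ ∑≤ n f * c
∑≤-distribʳ-* zero f c = refl
∑≤-distribʳ-* (suc n) f c = begin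
  ∑[ a ≤ n ] (f a * c) + f (suc n) * c ≡⟨ cong (_+ f (suc n) * c) (∑≤-distribʳ-* n f c) ⟩
  ∑≤ n f * c + f (suc n) * c          ≡⟨ *-distribʳ-+ c (∑≤ n f) (f (suc n)) ⟨
  ∑≤ (suc n) f * c                    ∎
  where open ≡-Reasoning

term≤∑≤ : ∀ f {a n} → a ≤ n → f a ≤ ∑≤ n f
term≤∑≤ f {zero} a≤n = ∑≤-monoʳ f a≤n
term≤∑≤ f {suc a} a≤n = ≤-trans (m≤n+m (f (suc a)) (∑≤ a f)) (∑≤-monoʳ f a≤n)

_↾_ : (ℕ → ℕ) → ℕ → ℕ → ℕ
(f ↾ y) a with a ≤? y
... | yes _ = f a
... | no _ = 0

↾-≤ : ∀ f {y a} → a ≤ y → (f ↾ y) a ≡ f a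
↾-≤ f {y} {a} a≤y with a ≤? y
... | yes _ = refl
... | no a≰y = contradiction a≤y a≰y

↾-> : ∀ f {y a} → y < a → (f ↾ y) a ≡ 0
↾-> f {y} {a} y<a with a ≤? y
... | yes a≤y = contradiction a≤y (<⇒≱ y<a)
... | no _ = refl

∑≤-↾ : ∀ f {y x} → y ≤ x → ∑≤ x (f ↾ y) ≡ ∑≤ y f
∑≤-↾ f y≤x = go (≤⇒≤′ y≤x)
  where
  go : ∀ {y x} → y ≤′ x → ∑≤ x (f ↾ y) ≡ ∑≤ y f
  go {y} ≤′-refl = ∑≤-cong y (λ a → ↾-≤ f)
  go {y} {suc x} (≤′-step y≤′x) =
    trans (cong₂ _+_ (go y≤′x) (↾-> f (s≤s (≤′⇒≤ y≤′x)))) (+-identityʳ (∑≤ y f))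

count-zero : ∀ A → count A 0 ≡ 𝟙 (A 0)
count-zero A with A 0
... | true = refl
... | false = refl

count-suc : ∀ A x → count A (suc x) ≡ count A x + 𝟙 (A (suc x))
count-suc A x with A (suc x)
... | true = refl
... | false = refl

count≡∑≤ : ∀ A n → count A n ≡ ∑≤ n (𝟙 ∘ A)
count≡∑≤ A zero = count-zero A
count≡∑≤ A (suc n) = trans (count-suc A n) (cong (_+ 𝟙 (A (suc n))) (count≡∑≤ A n))

count-mono : ∀ A {m n} → m ≤ n → count A m ≤ count A n
count-mono A {m} {n} m≤n =
  subst₂ _≤_ (sym (count≡∑≤ A m)) (sym (count≡∑≤ A n)) (∑≤-monoʳ (𝟙 ∘ A) m≤n)

maxCount : NatSet → NatSet → ℕ → ℕ
maxCount A B x = count A x ⊔ count B x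

module _ (A B : NatSet) where

  pairs : ℕ → ℕ
  pairs x = ∑[ a ≤ x ] (𝟙 (A a) * count B (x ∸ a))

  representations : ℕ → ℕ
  representations n = ∑[ a ≤ n ] (𝟙 (A a) * 𝟙 (B (n ∸ a)))

  pairs-suc : ∀ x → pairs (suc x) ≡ pairs x + representations (suc x)
  pairs-suc x = begin
    ∑[ a ≤ x ] (𝟙 (A a) * count B (suc x ∸ a)) + 𝟙 (A (suc x)) * count B (x ∸ x)
      ≡⟨ cong₂ _+_ (∑≤-cong x split) last ⟩
    ∑[ a ≤ x ] (𝟙 (A a) * count B (x ∸ a) + 𝟙 (A a) * 𝟙 (B (suc x ∸ a)))
      + 𝟙 (A (suc x)) * 𝟙 (B (x ∸ x))
      ≡⟨ cong (_+ 𝟙 (A (suc x)) * 𝟙 (B (x ∸ x))) (∑≤-distrib-+ x _ _) ⟩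
    (pairs x + ∑[ a ≤ x ] (𝟙 (A a) * 𝟙 (B (suc x ∸ a)))) + 𝟙 (A (suc x)) * 𝟙 (B (x ∸ x))
      ≡⟨ +-assoc (pairs x) _ _ ⟩
    pairs x + representations (suc x) ∎
    where
    open ≡-Reasoning
    split : ∀ a → a ≤ x → 𝟙 (A a) * count B (suc x ∸ a)
                        ≡ 𝟙 (A a) * count B (x ∸ a) + 𝟙 (A a) * 𝟙 (B (suc x ∸ a))
    split a a≤x rewrite +-∸-assoc 1 a≤x | count-suc B (x ∸ a) = *-distribˡ-+ (𝟙 (A a)) _ _
    last : 𝟙 (A (suc x)) * count B (x ∸ x) ≡ 𝟙 (A (suc x)) * 𝟙 (B (x ∸ x))
    last rewrite n∸n≡0 x = cong (𝟙 (A (suc x)) *_) (count-zero B)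

  representations-pos : ∀ {a b} → a ∈ₛ A → b ∈ₛ B → 1 ≤ representations (a + b)
  representations-pos {a} {b} a∈A b∈B =
    ≤-trans one (term≤∑≤ (λ a′ → 𝟙 (A a′) * 𝟙 (B (a + b ∸ a′))) (m≤m+n a b))
    where
    one : 1 ≤ 𝟙 (A a) * 𝟙 (B (a + b ∸ a))
    one rewrite m+n∸m≡n a b | a∈A | b∈B = ≤-refl

  pairs-lower : (ac : AdditiveComplements A B) → ∀ x → x ≤ pairs x + proj₁ ac
  pairs-lower ac zero = z≤n
  pairs-lower ac@(N , complete) (suc x) with N ≤? suc x
  ... | no N≰1+x = ≤-trans (<⇒≤ (≰⇒> N≰1+x)) (m≤n+m N (pairs (suc x)))
  ... | yes N≤1+x with complete (suc x) N≤1+x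
  ...   | a , b , a∈A , b∈B , a+b≡1+x = begin
    suc x                                  ≤⟨ +-mono-≤ represented (pairs-lower ac x) ⟩
    representations (suc x) + (pairs x + N) ≡⟨ +-comm-middle (representations (suc x)) (pairs x) N ⟩
    (pairs x + representations (suc x)) + N ≡⟨ cong (_+ N) (pairs-suc x) ⟨
    pairs (suc x) + N                      ∎
    where
    open ≤-Reasoning
    represented : 1 ≤ representations (suc x)
    represented = subst (λ n → 1 ≤ representations n) a+b≡1+x (representations-pos a∈A b∈B)
    +-comm-middle : ∀ r p n → r + (p + n) ≡ (p + r) + n
    +-comm-middle = solve-∀

  pairs-upper : ∀ {x y} → y ≤ x →
    pairs x ≤ count A x * count B (x ∸ y) + count A y * (count B x ∸ count B (x ∸ y))
  pairs-upper {x} {y} y≤x = begin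
    pairs x
      ≤⟨ ∑≤-mono x (λ a _ → term-bound a) ⟩
    ∑[ a ≤ x ] (𝟙 (A a) * Z + ((λ a′ → 𝟙 (A a′) * D) ↾ y) a)
      ≡⟨ ∑≤-distrib-+ x _ _ ⟩
    ∑[ a ≤ x ] (𝟙 (A a) * Z) + ∑≤ x ((λ a′ → 𝟙 (A a′) * D) ↾ y)
      ≡⟨ cong₂ _+_ (∑≤-distribʳ-* x (𝟙 ∘ A) Z) (∑≤-↾ _ y≤x) ⟩
    ∑≤ x (𝟙 ∘ A) * Z + ∑[ a ≤ y ] (𝟙 (A a) * D)
      ≡⟨ cong (∑≤ x (𝟙 ∘ A) * Z +_) (∑≤-distribʳ-* y (𝟙 ∘ A) D) ⟩
    ∑≤ x (𝟙 ∘ A) * Z + ∑≤ y (𝟙 ∘ A) * D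
      ≡⟨ cong₂ (λ u v → u * Z + v * D) (count≡∑≤ A x) (count≡∑≤ A y) ⟨
    count A x * Z + count A y * D ∎
    where
    open ≤-Reasoning
    Z = count B (x ∸ y)
    D = count B x ∸ Z
    term-bound : ∀ a → 𝟙 (A a) * count B (x ∸ a) ≤ 𝟙 (A a) * Z + ((λ a′ → 𝟙 (A a′) * D) ↾ y) a
    term-bound a with a ≤? y
    ... | yes _ = begin
      𝟙 (A a) * count B (x ∸ a) ≤⟨ *-monoʳ-≤ (𝟙 (A a)) (count-mono B (m∸n≤m x a)) ⟩
      𝟙 (A a) * count B x       ≡⟨ cong (𝟙 (A a) *_) (m+[n∸m]≡n (count-mono B (m∸n≤m x y))) ⟨
      𝟙 (A a) * (Z + D)         ≡⟨ *-distribˡ-+ (𝟙 (A a)) Z D ⟩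
      𝟙 (A a) * Z + 𝟙 (A a) * D ∎
    ... | no a≰y = begin
      𝟙 (A a) * count B (x ∸ a) ≤⟨ *-monoʳ-≤ (𝟙 (A a)) (count-mono B (∸-monoʳ-≤ x (<⇒≤ (≰⇒> a≰y)))) ⟩
      𝟙 (A a) * Z               ≡⟨ +-identityʳ _ ⟨
      𝟙 (A a) * Z + 0           ∎

split-bound : ∀ {U V Z D u e w z} → U ≤ u → V ≤ u + e → Z + D ≤ w → Z ≤ z →
  V * Z + U * D ≤ u * w + e * z
split-bound {U} {V} {Z} {D} {u} {e} {w} {z} U≤u V≤u+e Z+D≤w Z≤z = begin
  V * Z + U * D       ≤⟨ +-mono-≤ (*-monoˡ-≤ Z V≤u+e) (*-monoˡ-≤ D U≤u) ⟩
  (u + e) * Z + u * D ≡⟨ regroup u e Z D ⟩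
  u * (Z + D) + e * Z ≤⟨ +-mono-≤ (*-monoʳ-≤ u Z+D≤w) (*-monoʳ-≤ e Z≤z) ⟩
  u * w + e * z       ∎
  where
  open ≤-Reasoning
  regroup : ∀ u e Z D → (u + e) * Z + u * D ≡ u * (Z + D) + e * Z
  regroup = solve-∀

-- 3² + 4² = 5²: with x = 25Q and y = 9Q, also x − y = 16Q is a sample point.
counting-bound : ∀ A B (ac : AdditiveComplements A B) c Q →
  maxCount A B (3 * 3 * Q) ≤ 3 * c → maxCount A B (4 * 4 * Q) ≤ 4 * c →
  maxCount A B (5 * 5 * Q) ≤ 5 * c → 5 * 5 * Q ≤ 23 * (c * c) + proj₁ ac
counting-bound A B ac c Q M₃ M₄ M₅ = begin
  x                                               ≤⟨ pairs-lower A B ac x ⟩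
  pairs A B x + N                                 ≤⟨ +-monoˡ-≤ N (pairs-upper A B y≤x) ⟩
  count A x * Z + count A y * (count B x ∸ Z) + N ≤⟨ +-monoˡ-≤ N (split-bound A[y] A[x] B[x] B[x-y]) ⟩
  3 * c * (5 * c) + 2 * c * (4 * c) + N           ≡⟨ cong (_+ N) (twenty-three c) ⟩
  23 * (c * c) + N                                ∎
  where
  open ≤-Reasoning
  N = proj₁ ac
  x = 5 * 5 * Q
  y = 3 * 3 * Q
  Z = count B (x ∸ y)
  y≤x : y ≤ x
  y≤x = *-monoˡ-≤ Q (m≤m+n 9 16)
  A[y] : count A y ≤ 3 * c
  A[y] = ≤-trans (m≤m⊔n _ _) M₃
  A[x] : count A x ≤ 3 * c + 2 * c
  A[x] = ≤-trans (m≤m⊔n _ _) (≤-trans M₅ (≤-reflexive (*-distribʳ-+ c 3 2)))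
  B[x] : Z + (count B x ∸ Z) ≤ 5 * c
  B[x] = ≤-trans (≤-reflexive (m+[n∸m]≡n (count-mono B (m∸n≤m x y)))) (≤-trans (m≤n⊔m _ _) M₅)
  B[x-y] : Z ≤ 4 * c
  B[x-y] rewrite sym (*-distribʳ-∸ Q 25 9) = ≤-trans (m≤n⊔m _ _) M₄
  twenty-three : ∀ c → 3 * c * (5 * c) + 2 * c * (4 * c) ≡ 23 * (c * c)
  twenty-three = solve-∀

≤-from-squares : ∀ r {m n} .{{_ : NonZero r}} → r ^ 2 * m ^ 2 ≤ r ^ 2 * n ^ 2 → m ≤ n
≤-from-squares r h =
  ≮⇒≥ (λ n<m → <⇒≱ (^-monoˡ-< 2 n<m) (*-cancelˡ-≤ (r ^ 2) {{m^n≢0 r 2}} h))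

-- The ring solver does not see through _^_, so squares in its lemmas are spelled
-- x * (x * 1), the normal form of x ^ 2.
overshoot : ∀ p r k N .{{_ : NonZero k}} → 23 * p ^ 2 < 25 * r ^ 2 → N < k →
  23 * ((k * p) * (k * p)) + N < 5 * 5 * (k * k * (r * r))
overshoot p r k N 23p²<25r² N<k = begin-strict
  23 * ((k * p) * (k * p)) + N     <⟨ +-monoʳ-< _ (<-≤-trans N<k (m≤m*n k k)) ⟩
  23 * ((k * p) * (k * p)) + k * k ≡⟨ factor-k² p k ⟩
  suc (23 * p ^ 2) * (k * k)       ≤⟨ *-monoˡ-≤ (k * k) 23p²<25r² ⟩
  25 * r ^ 2 * (k * k)             ≡⟨ factor-25 r k ⟩
  5 * 5 * (k * k * (r * r))        ∎
  where
  open ≤-Reasoning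
  factor-k² : ∀ p k → 23 * ((k * p) * (k * p)) + k * k ≡ (1 + 23 * (p * (p * 1))) * (k * k)
  factor-k² = solve-∀
  factor-25 : ∀ r k → 25 * (r * (r * 1)) * (k * k) ≡ 25 * (k * k * (r * r))
  factor-25 = solve-∀

25R≤23P⇒20R²≤5P²+13PR : ∀ {P R} → 25 * R ≤ 23 * P → 20 * (R * R) ≤ 5 * (P * P) + 13 * (P * R)
25R≤23P⇒20R²≤5P²+13PR {P} {R} 25R≤23P = *-cancelˡ-≤ 529 (begin
  529 * (20 * (R * R))                            ≡⟨ expand R ⟩
  10580 * (R * R)                                 ≤⟨ *-monoˡ-≤ (R * R) (m≤m+n 10580 20) ⟩
  10600 * (R * R)                                 ≡⟨ expand′ R ⟩
  5 * (25 * R * (25 * R)) + 299 * (25 * R * R)    ≤⟨ +-mono-≤ (*-monoʳ-≤ 5 (*-mono-≤ 25R≤23P 25R≤23P))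
                                                              (*-monoʳ-≤ 299 (*-monoˡ-≤ R 25R≤23P)) ⟩
  5 * (23 * P * (23 * P)) + 299 * (23 * P * R)    ≡⟨ factor P R ⟩
  529 * (5 * (P * P) + 13 * (P * R))              ∎)
  where
  open ≤-Reasoning
  expand : ∀ R → 529 * (20 * (R * R)) ≡ 10580 * (R * R)
  expand = solve-∀
  expand′ : ∀ R → 10600 * (R * R) ≡ 5 * (25 * R * (25 * R)) + 299 * (25 * R * R)
  expand′ = solve-∀
  factor : ∀ P R → 5 * (23 * P * (23 * P)) + 299 * (23 * P * R) ≡ 529 * (5 * (P * P) + 13 * (P * R))
  factor = solve-∀

25R≤23P⇒4R[5R∸2P]≤5P[P+R] : ∀ {P R} → 25 * R ≤ 23 * P → 4 * (R * (5 * R ∸ 2 * P)) ≤ 5 * (P * (P + R))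
25R≤23P⇒4R[5R∸2P]≤5P[P+R] {P} {R} 25R≤23P = begin
  4 * (R * (5 * R ∸ 2 * P))             ≡⟨ cong (4 *_) (*-distribˡ-∸ R (5 * R) (2 * P)) ⟩
  4 * (R * (5 * R) ∸ R * (2 * P))       ≡⟨ *-distribˡ-∸ 4 (R * (5 * R)) (R * (2 * P)) ⟩
  4 * (R * (5 * R)) ∸ 4 * (R * (2 * P)) ≤⟨ m≤n+o⇒m∸n≤o (4 * (R * (5 * R))) (4 * (R * (2 * P))) cleared ⟩
  5 * (P * (P + R))                     ∎
  where
  open ≤-Reasoning
  lhs : ∀ R → 4 * (R * (5 * R)) ≡ 20 * (R * R)
  lhs = solve-∀
  rhs : ∀ P R → 5 * (P * P) + 13 * (P * R) ≡ 4 * (R * (2 * P)) + 5 * (P * (P + R))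
  rhs = solve-∀
  cleared : 4 * (R * (5 * R)) ≤ 4 * (R * (2 * P)) + 5 * (P * (P + R))
  cleared = subst₂ _≤_ (sym (lhs R)) (rhs P R) (25R≤23P⇒20R²≤5P²+13PR {P} {R} 25R≤23P)

-- Square 4 R S ≤ 5 P (P + R) and use (5/4)² < 2.
quartic-bound : ∀ {P R} → 25 * R ≤ 23 * P → (R * (5 * R ∸ 2 * P)) ^ 2 ≤ 2 * (P * (P + R)) ^ 2
quartic-bound {P} {R} 25R≤23P = *-cancelˡ-≤ 16 (begin
  16 * (R * S) ^ 2        ≡⟨ square-scale 4 (R * S) ⟩
  (4 * (R * S)) ^ 2       ≤⟨ ^-monoˡ-≤ 2 (25R≤23P⇒4R[5R∸2P]≤5P[P+R] {P} {R} 25R≤23P) ⟩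
  (5 * T) ^ 2             ≡⟨ square-scale 5 T ⟨
  25 * T ^ 2              ≤⟨ *-monoˡ-≤ (T ^ 2) (m≤m+n 25 7) ⟩
  32 * T ^ 2              ≡⟨ *-assoc 16 2 (T ^ 2) ⟩
  16 * (2 * T ^ 2)        ∎)
  where
  open ≤-Reasoning
  S = 5 * R ∸ 2 * P
  T = P * (P + R)
  square-scale : ∀ c u → c * (c * 1) * (u * (u * 1)) ≡ (c * u) * ((c * u) * 1)
  square-scale = solve-∀

below-sqrt1+C0⇒23p²<25r² : ∀ {p r} → BelowSqrt1+C0 p r → 23 * p ^ 2 < 25 * r ^ 2
below-sqrt1+C0⇒23p²<25r² {p} {r} (_ , below) = ≰⇒> λ 25r²≤23p² →
  <⇒≱ below (subst₂ _≤_ (sym (quartic-r r S)) (sym (quartic-p p r))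
    (quartic-bound {p ^ 2} {r ^ 2} 25r²≤23p²))
  where
  S = 5 * r ^ 2 ∸ 2 * p ^ 2
  quartic-r : ∀ r s → let R = r * (r * 1) in
    r * (r * (r * (r * 1))) * (s * (s * 1)) ≡ (R * s) * ((R * s) * 1)
  quartic-r = solve-∀
  quartic-p : ∀ p r → let P = p * (p * 1); R = r * (r * 1) in
    2 * (p * (p * (p * (p * 1)))) * ((P + R) * ((P + R) * 1)) ≡ 2 * ((P * (P + R)) * ((P * (P + R)) * 1))
  quartic-p = solve-∀

theorem2 : (A B : NatSet) → AdditiveComplements A B → LimsupMaxAtLeastSqrt1+C0 A B
theorem2 A B ac p r 1≤r below (N , eventually) =
  <⇒≱ (overshoot p r k (proj₁ ac) (below-sqrt1+C0⇒23p²<25r² {p} {r} below) (s≤s (m≤n+m _ N)))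
      (counting-bound A B ac (k * p) Q (sample 3) (sample 4) (sample 5))
  where
  instance
    r≢0 : NonZero r
    r≢0 = >-nonZero 1≤r
  k = suc (N + proj₁ ac)
  Q = k * k * (r * r)
  rescale : ∀ p r k d → let c = d * (k * p) in
    p * (p * 1) * (d * d * (k * k * (r * r))) ≡ r * (r * 1) * (c * (c * 1))
  rescale = solve-∀
  N≤ : ∀ d .{{_ : NonZero d}} → N ≤ d * d * Q
  N≤ d = begin
    N         ≤⟨ m≤n⇒m≤1+n (m≤m+n N (proj₁ ac)) ⟩
    k         ≤⟨ m≤m*n k k ⟩
    k * k     ≤⟨ m≤m*n (k * k) (r * r) {{m*n≢0 r r}} ⟩
    Q         ≤⟨ m≤n*m Q (d * d) {{m*n≢0 d d}} ⟩
    d * d * Q ∎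
    where open ≤-Reasoning
  sample : ∀ d .{{_ : NonZero d}} → maxCount A B (d * d * Q) ≤ d * (k * p)
  sample d = ≤-from-squares r
    (subst (r ^ 2 * maxCount A B (d * d * Q) ^ 2 ≤_) (rescale p r k d) (eventually _ (N≤ d)))
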